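{- For all integers $k,n\ge1$ there exists $M(k,n)\in\mathbb{N}^*$ such that for every finite directed graph $G$ there exists a sequence of $k$-edge-colorings $(\alpha_1,\dots,\alpha_{M(k,n)})$ of $G$ such that for every $k$-edge-coloring $\beta$ of $G$, $\min_{1\le i\le M(k,n)} d_k(\beta,\alpha_i)\le 2^{ -n}$.
   Context: For a finite (directed) graph $G$, orientations are ignored when computing ranks: $\rho_G(F)=\frac{1}{|V(G)|}(|V(G)|-c(F))$ for $F\subseteq E(G)$, where $c(F)$ is the number of connected components of $(V(G),F)$. A $k$-edge-coloring is any map $\alpha:E(G)\to[k]$ (not necessarily proper), and $\rho_{G,\alpha}$ is the vector $(\rho_G(\alpha^{ -1}(A)))_{A\subseteq[k]}\in\mathbb{R}^{2^k}$. For two $k$-edge-colorings $\alpha,\beta$ of $G$, $d_k(\alpha,\beta)$ is the Euclidean distance between $\rho_{G,\alpha}$ and $\rho_{G,\beta}$ in $\mathbb{R}^{2^k}$. -}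

module Defs where

open import Data.Nat using (ℕ; zero; suc; _∸_; _≥_)
open import Data.Bool using (Bool; true; false; _∧_; _∨_; not; if_then_else_)
open import Data.Fin using (Fin; zero; suc; _≟_; _<?_)
open import Data.Integer using (+_)
open import Data.Rational using (ℚ; 0ℚ; 1ℚ; ½; _+_; _-_; _*_; _/_)
open import Relation.Nullary.Decidable using (⌊_⌋)

record Digraph : Set where
  field
    V   : ℕ
    E   : ℕ
    src : Fin E → Fin V
    tgt : Fin E → Fin V
open Digraph public

anyFin : ∀ {n} → (Fin n → Bool) → Bool
anyFin {zero}  p = false
anyFin {suc n} p = p zero ∨ anyFin (λ i → p (suc i))

countFin : ∀ {n} → (Fin n → Bool) → ℕ
countFin {zero}  p = 0
countFin {suc n} p = (if p zero then 1 else 0) Data.Nat.+ countFin (λ i → p (suc i))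

EdgeSet : Digraph → Set
EdgeSet G = Fin (E G) → Bool

step : (G : Digraph) → EdgeSet G → (Fin (V G) → Bool) → (Fin (V G) → Bool)
step G F S w = S w ∨ anyFin (λ e → F e ∧
   ((S (src G e) ∧ ⌊ tgt G e ≟ w ⌋) ∨ (S (tgt G e) ∧ ⌊ src G e ≟ w ⌋)))

iter : ∀ {A : Set} → ℕ → (A → A) → A → A
iter zero    f a = a
iter (suc n) f a = f (iter n f a)

-- vertex set of the connected component of u in (V(G), F) (orientations ignored);
-- |V| rounds of expansion suffice.
component : (G : Digraph) → EdgeSet G → Fin (V G) → (Fin (V G) → Bool)
component G F u = iter (V G) (step G F) (λ w → ⌊ w ≟ u ⌋)

isRep : (G : Digraph) → EdgeSet G → Fin (V G) → Bool
isRep G F u = not (anyFin (λ w → component G F u w ∧ ⌊ w <? u ⌋))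

numComponents : (G : Digraph) → EdgeSet G → ℕ
numComponents G F = countFin (isRep G F)

-- ρ_G(F) = (|V| - c(F)) / |V|   (convention: 0 for the empty graph)
rho : (G : Digraph) → EdgeSet G → ℚ
rho G F with V G
... | zero  = 0ℚ
... | suc v = (+ (suc v ∸ numComponents G F)) / suc v

Coloring : ℕ → Digraph → Set
Coloring k G = Fin (E G) → Fin k

preimage : ∀ {k} (G : Digraph) → Coloring k G → (Fin k → Bool) → EdgeSet G
preimage G α A e = A (α e)

consF : ∀ {k} → Bool → (Fin k → Bool) → (Fin (suc k) → Bool)
consF b A zero    = b
consF b A (suc i) = A i

sumSubsets : ∀ k → ((Fin k → Bool) → ℚ) → ℚ
sumSubsets zero    f = f (λ ())
sumSubsets (suc k) f = sumSubsets k (λ A → f (consF true A)) + sumSubsets k (λ A → f (consF false A))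

-- squared Euclidean distance d_k(α,β)² between ρ_{G,α} and ρ_{G,β} in ℝ^{2^k}
dist² : ∀ k (G : Digraph) → Coloring k G → Coloring k G → ℚ
dist² k G α β = sumSubsets k (λ A →
  (rho G (preimage G α A) - rho G (preimage G β A)) *
  (rho G (preimage G α A) - rho G (preimage G β A)))

half^ : ℕ → ℚ
half^ zero    = 1ℚ
half^ (suc n) = ½ * half^ n

{-# OPTIONS --safe #-}
-- Quantise every coordinate ρ_G(α⁻¹(A)) = (|V| − c)/|V| of ρ_{G,α} to one of 2^j + 1 levels,
-- j = k + 2n. Two colourings with the same 2^k levels ("profile") satisfy 2^j·|a − b| < |V| and
-- |a − b| ≤ |V| for the rank numerators a, b of each coordinate, so each squared coordinate
-- difference is at most 2^(−j) and d_k² ≤ 2^k · 2^(−j) = 2^(−2n). There are finitely many profiles,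
-- independently of G, and one colouring realising each profile is found by exhaustive search.

module Submission where

open import Defs
open import Data.Nat using (ℕ; _≥_)
open import Data.Fin using (Fin)
open import Data.Product using (Σ; ∃; _×_)
open import Data.Rational using (_≤_; _*_)

open import Data.Bool using (Bool; true; false; _∧_; _∨_; not; if_then_else_)
open import Data.Empty using (⊥-elim)
open import Data.Fin as Fin using (zero; suc; fromℕ<)
open import Data.Fin.Properties using (any?; fromℕ<-injective)
open import Data.Integer as ℤ using (+_; _⊖_)
import Data.Integer.Properties as ℤ
open import Data.List using (List; cartesianProduct; length; lookup; allFin)
open import Data.List.Membership.Propositional using (_∈_)
open import Data.List.Membership.Propositional.Properties
  using (∈-cartesianProduct⁺; ∈-allFin; ∈-length)
open import Data.List.Relation.Unary.Any using (index)
open import Data.List.Relation.Unary.Any.Properties using (lookup-index)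
open import Data.Nat as ℕ using (zero; suc; _+_; _∸_; _⊔_; _^_; ∣_-_∣)
import Data.Nat.Properties as ℕ
open import Data.Nat.DivMod using (/-monoˡ-≤; m*n/n≡m; m≡m%n+[m/n]*n; m%n<n)
open import Data.Product using (_,_; proj₁; proj₂)
open import Data.Product.Properties using (≡-dec)
open import Data.Rational as ℚ using (ℚ; ½; 0ℚ; _/_; _-_; -_; toℚᵘ)
import Data.Rational.Properties as ℚ
open import Data.Rational.Unnormalised as ℚᵘ using (mkℚᵘ; *≡*; *≤*)
import Data.Rational.Unnormalised.Properties as ℚᵘ
open import Data.Vec.Functional using (_∷_)
open import Function using (_∘_)
open import Relation.Binary.Definitions using (DecidableEquality)
open import Relation.Binary.PropositionalEquality
open import Relation.Nullary using (Dec; yes; no)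
import Relation.Nullary.Decidable as Dec
open import Relation.Unary using (Decidable)

anyFin-cong : ∀ {n} {p q : Fin n → Bool} → p ≗ q → anyFin p ≡ anyFin q
anyFin-cong {zero}  p≗q = refl
anyFin-cong {suc n} p≗q = cong₂ _∨_ (p≗q zero) (anyFin-cong (p≗q ∘ suc))

countFin-cong : ∀ {n} {p q : Fin n → Bool} → p ≗ q → countFin p ≡ countFin q
countFin-cong {zero}  p≗q = refl
countFin-cong {suc n} p≗q =
  cong₂ _+_ (cong (λ b → if b then 1 else 0) (p≗q zero)) (countFin-cong (p≗q ∘ suc))

module _ (G : Digraph) {F F′ : EdgeSet G} (F≗F′ : F ≗ F′) where

  step-cong : ∀ {S S′} → S ≗ S′ → step G F S ≗ step G F′ S′
  step-cong S≗S′ w = cong₂ _∨_ (S≗S′ w) (anyFin-cong λ e → cong₂ _∧_ (F≗F′ e)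
    (cong₂ _∨_ (cong (_∧ _) (S≗S′ (src G e))) (cong (_∧ _) (S≗S′ (tgt G e)))))

  component-cong : ∀ u → component G F u ≗ component G F′ u
  component-cong u = iter-cong (V G) (λ _ → refl)
    where
    iter-cong : ∀ m {S S′} → S ≗ S′ → iter m (step G F) S ≗ iter m (step G F′) S′
    iter-cong zero    S≗S′ = S≗S′
    iter-cong (suc m) S≗S′ = step-cong (iter-cong m S≗S′)

  numComponents-cong : numComponents G F ≡ numComponents G F′
  numComponents-cong = countFin-cong λ u →
    cong not (anyFin-cong λ w → cong (_∧ _) (component-cong u w))

-- Without function extensionality f is only pointwise equal to f zero ∷ f ∘ suc, hence the
-- hypothesis that P respects _≗_.
∃-function? : ∀ {m n} {P : (Fin m → Fin n) → Set} →
  (∀ {f g} → f ≗ g → P f → P g) → Decidable P → Dec (∃ P)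
∃-function? {zero}  resp P? =
  Dec.map′ (λ p → _ , p) (λ (f , p) → resp (λ ()) p) (P? (λ ()))
∃-function? {suc m} resp P? =
  Dec.map′ (λ (c , f , p) → c ∷ f , p) (λ (f , p) → f zero , f ∘ suc , resp head∷tail p)
    (any? λ c → ∃-function? (λ f≗g → resp (∷-cong f≗g)) (P? ∘ (c ∷_)))
  where
  head∷tail : ∀ {f : Fin (suc m) → _} → f ≗ (f zero ∷ f ∘ suc)
  head∷tail zero    = refl
  head∷tail (suc i) = refl
  ∷-cong : ∀ {c} {f g : Fin m → _} → f ≗ g → (c ∷ f) ≗ (c ∷ g)
  ∷-cong f≗g zero    = refl
  ∷-cong f≗g (suc i) = f≗g i

finite-image-cover : ∀ {X K : Set} (key : X → K) → X → (∀ y → Dec (∃ λ x → key x ≡ y)) →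
  (ks : List K) → (∀ y → y ∈ ks) →
  Σ (Fin (length ks) → X) λ xs → ∀ x → ∃ λ i → key (xs i) ≡ key x
finite-image-cover {X} {K} key x₀ search ks ∈ks = representative ∘ lookup ks , λ x →
  let key-x∈ks = ∈ks (key x) in
  index key-x∈ks , trans (representative-key (lookup-index key-x∈ks)) (sym (lookup-index key-x∈ks))
  where
  representative : K → X
  representative y with search y
  ... | yes (x , _) = x
  ... | no _        = x₀
  representative-key : ∀ {x y} → key x ≡ y → key (representative y) ≡ y
  representative-key {x} {y} key-x≡y with search y
  ... | yes (_ , key-x′≡y) = key-x′≡y
  ... | no ∄x              = ⊥-elim (∄x (x , key-x≡y))

Subset : ℕ → Set
Subset k = Fin k → Bool

-- Follows the recursion of sumSubsets.
AllSubsets : ∀ k → (Subset k → Set) → Set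
AllSubsets zero    P = P (λ ())
AllSubsets (suc k) P = AllSubsets k (P ∘ consF true) × AllSubsets k (P ∘ consF false)

Table : Set → ℕ → Set
Table A k = AllSubsets k (λ _ → A)

tabulate : ∀ k {A : Set} → (Subset k → A) → Table A k
tabulate zero    f = f (λ ())
tabulate (suc k) f = tabulate k (f ∘ consF true) , tabulate k (f ∘ consF false)

mapAll : ∀ k {P Q : Subset k → Set} → (∀ {A} → P A → Q A) → AllSubsets k P → AllSubsets k Q
mapAll zero    f p         = f p
mapAll (suc k) f (pᵗ , pᶠ) = mapAll k f pᵗ , mapAll k f pᶠ

tabulate-cong : ∀ k {A : Set} {f g : Subset k → A} → f ≗ g → tabulate k f ≡ tabulate k g
tabulate-cong zero    f≗g = f≗g (λ ())
tabulate-cong (suc k) f≗g =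
  cong₂ _,_ (tabulate-cong k (f≗g ∘ consF true)) (tabulate-cong k (f≗g ∘ consF false))

tabulate-injective : ∀ k {A : Set} {f g : Subset k → A} →
  tabulate k f ≡ tabulate k g → AllSubsets k (λ A → f A ≡ g A)
tabulate-injective zero    eq = eq
tabulate-injective (suc k) eq =
  tabulate-injective k (cong proj₁ eq) , tabulate-injective k (cong proj₂ eq)

Table-≟ : ∀ k {A : Set} → DecidableEquality A → DecidableEquality (Table A k)
Table-≟ zero    _≟_ = _≟_
Table-≟ (suc k) _≟_ = ≡-dec (Table-≟ k _≟_) (Table-≟ k _≟_)

allTables : ∀ k {A : Set} → List A → List (Table A k)
allTables zero    xs = xs
allTables (suc k) xs = cartesianProduct (allTables k xs) (allTables k xs)

∈-allTables : ∀ k {A : Set} {xs : List A} → (∀ x → x ∈ xs) → ∀ t → t ∈ allTables k xs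
∈-allTables zero    ∈xs t         = ∈xs t
∈-allTables (suc k) ∈xs (tᵗ , tᶠ) =
  ∈-cartesianProduct⁺ (∈-allTables k ∈xs tᵗ) (∈-allTables k ∈xs tᶠ)

sumSubsets-mono-≤ : ∀ k {t u : Subset k → ℚ} → AllSubsets k (λ A → t A ≤ u A) →
  sumSubsets k t ≤ sumSubsets k u
sumSubsets-mono-≤ zero    t≤u           = t≤u
sumSubsets-mono-≤ (suc k) (t≤uᵗ , t≤uᶠ) =
  ℚ.+-mono-≤ (sumSubsets-mono-≤ k t≤uᵗ) (sumSubsets-mono-≤ k t≤uᶠ)

half^-+ : ∀ m n → half^ (m + n) ≡ half^ m * half^ n
half^-+ zero    n = sym (ℚ.*-identityˡ (half^ n))
half^-+ (suc m) n = trans (cong (½ *_) (half^-+ m n)) (sym (ℚ.*-assoc ½ (half^ m) (half^ n)))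

half^[1+m]+half^[1+m]≡half^m : ∀ m → half^ (suc m) ℚ.+ half^ (suc m) ≡ half^ m
half^[1+m]+half^[1+m]≡half^m m =
  trans (sym (ℚ.*-distribʳ-+ (half^ m) ½ ½)) (ℚ.*-identityˡ (half^ m))

sumSubsets-half^ : ∀ k m → sumSubsets k (λ _ → half^ (k + m)) ≡ half^ m
sumSubsets-half^ zero    m = refl
sumSubsets-half^ (suc k) m = begin
  twice (suc k + m)               ≡⟨ cong twice (ℕ.+-suc k m) ⟨
  twice (k + suc m)               ≡⟨ cong₂ ℚ._+_ IH IH ⟩
  half^ (suc m) ℚ.+ half^ (suc m) ≡⟨ half^[1+m]+half^[1+m]≡half^m m ⟩
  half^ m                         ∎
  where
  open ≡-Reasoning
  twice : ℕ → ℚ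
  twice i = sumSubsets k (λ _ → half^ i) ℚ.+ sumSubsets k (λ _ → half^ i)
  IH : sumSubsets k (λ _ → half^ (k + suc m)) ≡ half^ (suc m)
  IH = sumSubsets-half^ k (suc m)

quantize : (M s a : ℕ) → ℕ
quantize M zero    a = 0
quantize M (suc v) a = M ℕ.* a ℕ./ suc v

quantize-≤ : ∀ M s {a} → a ℕ.≤ s → quantize M s a ℕ.≤ M
quantize-≤ M zero    a≤s = ℕ.z≤n
quantize-≤ M (suc v) a≤s =
  ℕ.≤-trans (/-monoˡ-≤ (suc v) (ℕ.*-monoʳ-≤ M a≤s)) (ℕ.≤-reflexive (m*n/n≡m M (suc v)))

quantize-≡⇒*∣-∣< : ∀ M v a b → quantize M (suc v) a ≡ quantize M (suc v) b →
  M ℕ.* ∣ a - b ∣ ℕ.< suc v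
quantize-≡⇒*∣-∣< M v a b same = begin-strict
  M ℕ.* ∣ a - b ∣                   ≡⟨ ℕ.*-distribˡ-∣-∣ M a b ⟩
  ∣ M ℕ.* a - M ℕ.* b ∣             ≡⟨ cong₂ ∣_-_∣ (div-mod a) (trans (div-mod b) same-quotient) ⟩
  ∣ q ℕ.* s + r a - q ℕ.* s + r b ∣ ≡⟨ ℕ.∣m+n-m+o∣≡∣n-o∣ (q ℕ.* s) (r a) (r b) ⟩
  ∣ r a - r b ∣                     ≤⟨ ℕ.∣m-n∣≤m⊔n (r a) (r b) ⟩
  r a ⊔ r b                         <⟨ ℕ.⊔-lub (m%n<n (M ℕ.* a) s) (m%n<n (M ℕ.* b) s) ⟩
  s                                 ∎
  where
  open ℕ.≤-Reasoning
  s q : ℕ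
  s = suc v
  q = quantize M s a
  r : ℕ → ℕ
  r x = M ℕ.* x ℕ.% s
  div-mod : ∀ x → M ℕ.* x ≡ quantize M s x ℕ.* s + r x
  div-mod x = trans (m≡m%n+[m/n]*n (M ℕ.* x) s) (ℕ.+-comm (r x) _)
  same-quotient : quantize M s b ℕ.* s + r b ≡ q ℕ.* s + r b
  same-quotient = cong (λ p → p ℕ.* s + r b) (sym same)

⊖-square : ∀ a b → (a ⊖ b) ℤ.* (a ⊖ b) ≡ + (∣ a - b ∣ ℕ.* ∣ a - b ∣)
⊖-square zero    zero    = refl
⊖-square zero    (suc b) = refl
⊖-square (suc a) zero    = refl
⊖-square (suc a) (suc b) rewrite ℤ.[1+m]⊖[1+n]≡m⊖n a b = ⊖-square a b

-- mkℚᵘ n d has denominator suc d, hence d = 2 ^ j ∸ 1 rather than 2 ^ j.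
toℚᵘ-half^ : ∀ j → ∃ λ d → suc d ≡ 2 ^ j × toℚᵘ (half^ j) ℚᵘ.≃ mkℚᵘ (+ 1) d
toℚᵘ-half^ zero    = 0 , refl , *≡* refl
toℚᵘ-half^ (suc j) with toℚᵘ-half^ j
... | d , 1+d≡2^j , half^j≃ =
  _ , cong (2 ℕ.*_) 1+d≡2^j , ℚᵘ.≃-trans (ℚ.toℚᵘ-homo-* ½ (half^ j)) (ℚᵘ.*-congˡ half^j≃)

0≤half^ : ∀ j → 0ℚ ≤ half^ j
0≤half^ j with toℚᵘ-half^ j
... | _ , _ , half^j≃ =
  ℚ.toℚᵘ-cancel-≤ (ℚᵘ.≤-respʳ-≃ (ℚᵘ.≃-sym half^j≃) (*≤* (ℤ.+≤+ ℕ.z≤n)))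

mkℚᵘ-sub-common-denominator : ∀ m n v → mkℚᵘ m v ℚᵘ.- mkℚᵘ n v ℚᵘ.≃ mkℚᵘ (m ℤ.- n) v
mkℚᵘ-sub-common-denominator m n v = *≡* (begin
  (m ℤ.* s ℤ.+ ℤ.- n ℤ.* s) ℤ.* s   ≡⟨ cong (ℤ._* s) (ℤ.*-distribʳ-+ s m (ℤ.- n)) ⟨
  (m ℤ.- n) ℤ.* s ℤ.* s             ≡⟨ ℤ.*-assoc (m ℤ.- n) s s ⟩
  (m ℤ.- n) ℤ.* (s ℤ.* s)           ≡⟨ cong ((m ℤ.- n) ℤ.*_) (ℤ.pos-* (suc v) (suc v)) ⟨
  (m ℤ.- n) ℤ.* + (suc v ℕ.* suc v) ∎)
  where
  open ≡-Reasoning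
  s : ℤ.ℤ
  s = + suc v

toℚᵘ-/-difference : ∀ v a b → toℚᵘ (+ a / suc v - + b / suc v) ℚᵘ.≃ mkℚᵘ (a ⊖ b) v
toℚᵘ-/-difference v a b = begin
  toℚᵘ (x - y)                   ≈⟨ ℚ.toℚᵘ-homo-+ x (- y) ⟩
  toℚᵘ x ℚᵘ.+ toℚᵘ (- y)         ≈⟨ ℚᵘ.+-congʳ (toℚᵘ x) (ℚ.toℚᵘ-homo‿- y) ⟩
  toℚᵘ x ℚᵘ.- toℚᵘ y             ≈⟨ ℚᵘ.+-cong (toℚᵘ-/ a) (ℚᵘ.-‿cong (toℚᵘ-/ b)) ⟩
  mkℚᵘ (+ a) v ℚᵘ.- mkℚᵘ (+ b) v ≈⟨ mkℚᵘ-sub-common-denominator (+ a) (+ b) v ⟩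
  mkℚᵘ (+ a ℤ.- + b) v           ≡⟨ cong (λ z → mkℚᵘ z v) (ℤ.m-n≡m⊖n a b) ⟩
  mkℚᵘ (a ⊖ b) v                 ∎
  where
  open ℚᵘ.≃-Reasoning
  x y : ℚ
  x = + a / suc v
  y = + b / suc v
  toℚᵘ-/ : ∀ c → toℚᵘ (+ c / suc v) ℚᵘ.≃ mkℚᵘ (+ c) v
  toℚᵘ-/ c = ℚ.toℚᵘ-fromℚᵘ (mkℚᵘ (+ c) v)

mkℚᵘ-⊖-square-≤ : ∀ a b v d → ∣ a - b ∣ ℕ.* ∣ a - b ∣ ℕ.* suc d ℕ.≤ suc v ℕ.* suc v →
  mkℚᵘ (a ⊖ b) v ℚᵘ.* mkℚᵘ (a ⊖ b) v ℚᵘ.≤ mkℚᵘ (+ 1) d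
mkℚᵘ-⊖-square-≤ a b v d bound = *≤* (begin
  (a ⊖ b) ℤ.* (a ⊖ b) ℤ.* + suc d         ≡⟨ cong (ℤ._* + suc d) (⊖-square a b) ⟩
  + (∣ a - b ∣ ℕ.* ∣ a - b ∣) ℤ.* + suc d ≡⟨ ℤ.pos-* (∣ a - b ∣ ℕ.* ∣ a - b ∣) (suc d) ⟨
  + (∣ a - b ∣ ℕ.* ∣ a - b ∣ ℕ.* suc d)   ≤⟨ ℤ.+≤+ bound ⟩
  + (suc v ℕ.* suc v)                     ≡⟨ ℤ.*-identityˡ _ ⟨
  + 1 ℤ.* + (suc v ℕ.* suc v)             ∎)
  where open ℤ.≤-Reasoning

/-difference²-≤-half^ : ∀ j v a b → ∣ a - b ∣ ℕ.* ∣ a - b ∣ ℕ.* 2 ^ j ℕ.≤ suc v ℕ.* suc v →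
  (+ a / suc v - + b / suc v) * (+ a / suc v - + b / suc v) ≤ half^ j
/-difference²-≤-half^ j v a b bound with toℚᵘ-half^ j
... | d , 1+d≡2^j , half^j≃ = ℚ.toℚᵘ-cancel-≤ (begin
  toℚᵘ (x-y * x-y)                   ≃⟨ ℚ.toℚᵘ-homo-* x-y x-y ⟩
  toℚᵘ x-y ℚᵘ.* toℚᵘ x-y             ≃⟨ ℚᵘ.*-cong (toℚᵘ-/-difference v a b) (toℚᵘ-/-difference v a b) ⟩
  mkℚᵘ (a ⊖ b) v ℚᵘ.* mkℚᵘ (a ⊖ b) v ≤⟨ mkℚᵘ-⊖-square-≤ a b v d (subst bounded (sym 1+d≡2^j) bound) ⟩
  mkℚᵘ (+ 1) d                       ≃⟨ half^j≃ ⟨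
  toℚᵘ (half^ j)                     ∎)
  where
  open ℚᵘ.≤-Reasoning
  x-y : ℚ
  x-y = + a / suc v - + b / suc v
  bounded : ℕ → Set
  bounded m = ∣ a - b ∣ ℕ.* ∣ a - b ∣ ℕ.* m ℕ.≤ suc v ℕ.* suc v

ratio : ℕ → ℕ → ℚ
ratio zero    a = 0ℚ
ratio (suc v) a = + a / suc v

rho≡ratio : ∀ G F → rho G F ≡ ratio (V G) (V G ∸ numComponents G F)
rho≡ratio record { V = zero  } F = refl
rho≡ratio record { V = suc v } F = refl

ratio-close : ∀ j s {a b} → a ℕ.≤ s → b ℕ.≤ s → quantize (2 ^ j) s a ≡ quantize (2 ^ j) s b →
  (ratio s a - ratio s b) * (ratio s a - ratio s b) ≤ half^ j
ratio-close j zero    _   _   _    = 0≤half^ j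
ratio-close j (suc v) {a} {b} a≤s b≤s same = /-difference²-≤-half^ j v a b (begin
  ∣ a - b ∣ ℕ.* ∣ a - b ∣ ℕ.* 2 ^ j   ≡⟨ ℕ.*-assoc ∣ a - b ∣ ∣ a - b ∣ (2 ^ j) ⟩
  ∣ a - b ∣ ℕ.* (∣ a - b ∣ ℕ.* 2 ^ j) ≡⟨ cong (∣ a - b ∣ ℕ.*_) (ℕ.*-comm ∣ a - b ∣ (2 ^ j)) ⟩
  ∣ a - b ∣ ℕ.* (2 ^ j ℕ.* ∣ a - b ∣) ≤⟨ ℕ.*-mono-≤ ∣a-b∣≤s (ℕ.<⇒≤ 2^j∣a-b∣<s) ⟩
  suc v ℕ.* suc v                     ∎)
  where
  open ℕ.≤-Reasoning
  ∣a-b∣≤s : ∣ a - b ∣ ℕ.≤ suc v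
  ∣a-b∣≤s = ℕ.≤-trans (ℕ.∣m-n∣≤m⊔n a b) (ℕ.⊔-lub a≤s b≤s)
  2^j∣a-b∣<s : 2 ^ j ℕ.* ∣ a - b ∣ ℕ.< suc v
  2^j∣a-b∣<s = quantize-≡⇒*∣-∣< (2 ^ j) v a b same

rankLevel : (M s c : ℕ) → Fin (suc M)
rankLevel M s c = fromℕ< (ℕ.s≤s (quantize-≤ M s (ℕ.m∸n≤m s c)))

rho-close : ∀ j G (F F′ : EdgeSet G) →
  rankLevel (2 ^ j) (V G) (numComponents G F) ≡ rankLevel (2 ^ j) (V G) (numComponents G F′) →
  (rho G F - rho G F′) * (rho G F - rho G F′) ≤ half^ j
rho-close j G F F′ same rewrite rho≡ratio G F | rho≡ratio G F′ =
  ratio-close j (V G) (ℕ.m∸n≤m (V G) (numComponents G F)) (ℕ.m∸n≤m (V G) (numComponents G F′))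
    (fromℕ<-injective _ _ _ _ same)

Profile : ℕ → ℕ → Set
Profile k j = Table (Fin (suc (2 ^ j))) k

profile : ∀ k j (G : Digraph) → Coloring k G → Profile k j
profile k j G α = tabulate k λ A → rankLevel (2 ^ j) (V G) (numComponents G (preimage G α A))

profile-cong : ∀ k j G {α β : Coloring k G} → α ≗ β → profile k j G α ≡ profile k j G β
profile-cong k j G α≗β =
  tabulate-cong k λ A → cong (rankLevel (2 ^ j) (V G)) (numComponents-cong G (cong A ∘ α≗β))

∃-profile? : ∀ k j G (t : Profile k j) → Dec (∃ λ α → profile k j G α ≡ t)
∃-profile? k j G t = ∃-function? (λ α≗β same → trans (sym (profile-cong k j G α≗β)) same)
  (λ α → Table-≟ k Fin._≟_ (profile k j G α) t)

allProfiles : ∀ k j → List (Profile k j)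
allProfiles k j = allTables k (allFin (suc (2 ^ j)))

∈-allProfiles : ∀ k j (t : Profile k j) → t ∈ allProfiles k j
∈-allProfiles k j = ∈-allTables k ∈-allFin

allProfiles-nonempty : ∀ k j → length (allProfiles k j) ≥ 1
allProfiles-nonempty k j = ∈-length (∈-allProfiles k j (tabulate k λ _ → zero))

same-profile⇒dist²≤ : ∀ k m G α β → profile k (k + m) G α ≡ profile k (k + m) G β →
  dist² k G α β ≤ half^ m
same-profile⇒dist²≤ k m G α β same = begin
  dist² k G α β
    ≤⟨ sumSubsets-mono-≤ k (mapAll k (rho-close (k + m) G _ _) (tabulate-injective k same)) ⟩
  sumSubsets k (λ _ → half^ (k + m))
    ≡⟨ sumSubsets-half^ k m ⟩
  half^ m ∎
  where open ℚ.≤-Reasoning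

profile-representatives : ∀ k m G → Coloring k G →
  Σ (Fin (length (allProfiles k (k + m))) → Coloring k G) λ αs →
    ∀ β → ∃ λ i → dist² k G β (αs i) ≤ half^ m
profile-representatives k m G α₀ =
  let αs , covers = finite-image-cover (profile k (k + m) G) α₀ (∃-profile? k (k + m) G)
                                       (allProfiles k (k + m)) (∈-allProfiles k (k + m))
  in αs , λ β → let i , same = covers β in i , same-profile⇒dist²≤ k m G β (αs i) (sym same)

lemma2p10 : (k n : ℕ) → k ≥ 1 → n ≥ 1 →
    Σ ℕ (λ M → M ≥ 1 ×
      ((G : Digraph) → Σ (Fin M → Coloring k G) (λ αs →
        (β : Coloring k G) → ∃ (λ i → dist² k G β (αs i) ≤ half^ n * half^ n))))
lemma2p10 zero    n () _
lemma2p10 (suc k) n _ _ =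
  length (allProfiles (suc k) j) , allProfiles-nonempty (suc k) j , λ G →
  let αs , close = profile-representatives (suc k) (n + n) G (λ _ → zero) in
  αs , λ β → let i , d²≤ = close β in i , subst (dist² (suc k) G β (αs i) ≤_) (half^-+ n n) d²≤
  where
  j : ℕ
  j = suc k + (n + n)
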